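{- Let $V=\{1,\dots,n\}$ and let $G=(V,E)$ be a directed cactus graph, i.e. a strongly connected simple digraph in which every directed edge is contained in exactly one directed cycle. Suppose $(i,j)\in E$ and both $i$ and $j$ have degree greater than one. For distinct vertices $\delta,\nu$, define $$V_\nu(\delta\rightarrow):=\{k\in V\setminus\{\delta,\nu\}:\ \text{there is a directed path from }\delta\text{ to }k\text{ which does not pass through }\nu\}.$$ Then $V$ is the disjoint union of the three sets $\{i,j\}$, $V_j(i\rightarrow)$ and $V_i(j\rightarrow)$.
   Context: $(i,j)\in E$ denotes a directed edge from $i$ to $j$. In a directed cactus every vertex has indegree equal to outdegree; this common value is the degree of the vertex. -}

module Defs where

open import Data.Nat using (ℕ; zero; suc; _<_)
open import Data.Fin using (Fin)
open import Data.Bool using (Bool; true; false; T; if_then_else_)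
open import Data.List using (List; []; _∷_; _++_; [_]; map; allFin)
open import Data.Nat.ListAction using (sum)
open import Data.List.Relation.Unary.Unique.Propositional using (Unique)
open import Data.List.Relation.Unary.Linked using (Linked)
open import Data.Product using (Σ; _×_)
open import Relation.Binary.PropositionalEquality using (_≡_; _≢_)

-- A digraph on V = Fin n, given by its (Boolean) adjacency matrix.
-- Simplicity (no multiple edges) is built in; loops are excluded in IsSimple.
Digraph : ℕ → Set
Digraph n = Fin n → Fin n → Bool

module _ {n : ℕ} (G : Digraph n) where

  Edge : Fin n → Fin n → Set
  Edge a b = T (G a b)

  IsSimple : Set
  IsSimple = ∀ a → G a a ≡ false

  data Walk : Fin n → Fin n → Set where
    here : ∀ {a} → Walk a a
    step : ∀ {a b c} → Edge a b → Walk b c → Walk a c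

  StronglyConnected : Set
  StronglyConnected = ∀ a b → Walk a b

  data WalkAvoiding (ν : Fin n) : Fin n → Fin n → Set where
    here : ∀ {a} → WalkAvoiding ν a a
    step : ∀ {a b c} → Edge a b → b ≢ ν → WalkAvoiding ν b c → WalkAvoiding ν a c

  -- A directed cycle containing the edge (i,j), written starting with i, j:
  -- a list c = i ∷ j ∷ rest of pairwise distinct vertices such that
  -- consecutive vertices of c ++ [ i ] are joined by edges.
  CycleThrough : Fin n → Fin n → List (Fin n) → Set
  CycleThrough i j c =
    Σ (List (Fin n)) (λ rest → c ≡ i ∷ j ∷ rest) × Unique c × Linked Edge (c ++ [ i ])

  EveryEdgeOnUniqueCycle : Set
  EveryEdgeOnUniqueCycle = ∀ i j → Edge i j →
    Σ (List (Fin n)) (CycleThrough i j) ×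
    (∀ c c′ → CycleThrough i j c → CycleThrough i j c′ → c ≡ c′)

  IsDirectedCactus : Set
  IsDirectedCactus = IsSimple × StronglyConnected × EveryEdgeOnUniqueCycle

  -- out-degree (= in-degree = degree in a directed cactus)
  degree : Fin n → ℕ
  degree a = sum (map (λ b → if G a b then 1 else 0) (allFin n))

  Reach∖ : (ν δ : Fin n) → Fin n → Set
  Reach∖ ν δ k = k ≢ δ × k ≢ ν × WalkAvoiding ν δ k

-- In a directed cactus, for an edge a → b every simple path from b to a closes
-- up to a cycle through (a , b), so all of them coincide.  Applied to loop
-- erasures: two walks from b to a that do not revisit b leave b along the same
-- edge, and every walk from b to a meets every vertex of a simple one.
--
-- A vertex k ∉ {i , j} lies in V_j(i →) or V_i(j →) according to the last
-- visit of {i , j} on a walk from i to k.  If k lay in both, walk on from k to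
-- the first vertex of {i , j}, entered by an edge z → i or z → j.  For z → i,
-- the walks i → j ⇝ k ⇝ z and i → x ⇝ k ⇝ z (x ≠ j) contradict the first
-- point.  For z → j, so do j → y ⇝ k ⇝ z and j ⇝ i ⇝ k ⇝ z unless the latter
-- also starts with j → y; but then the walk y ⇝ k ⇝ z → j avoids i, while the
-- simple path from y along the cycle of (i , j) to j passes through i.
module Submission where

open import Defs
open import Data.Nat using (ℕ; _<_)
open import Data.Fin using (Fin)
open import Data.Fin.Properties using (_≟_)
open import Data.Bool using (T)
open import Data.Empty using (⊥; ⊥-elim)
open import Data.List using (List; []; _∷_; _++_; [_])
open import Data.List.Properties using (∷-injectiveˡ; ∷-injectiveʳ)
open import Data.List.Membership.Propositional using (_∈_; _∉_)
open import Data.List.Membership.Propositional.Properties using (∈-++⁺ˡ; ∈-++⁻)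
open import Data.List.Relation.Binary.Subset.Propositional using (_⊆_)
open import Data.List.Relation.Unary.All as All using (All; _∷_)
open import Data.List.Relation.Unary.All.Properties using (¬Any⇒All¬; ++⁻; ++⁺)
open import Data.List.Relation.Unary.Any using (Any; here; there; any?)
open import Data.List.Relation.Unary.AllPairs using ([]; _∷_)
open import Data.List.Relation.Unary.Linked using (Linked; [-]; _∷_)
open import Data.List.Relation.Unary.Unique.Propositional using (Unique)
open import Data.List.Relation.Unary.Unique.Propositional.Properties using (Unique[x∷xs]⇒x∉xs)
open import Data.Product using (Σ; ∃; ∃₂; _×_; _,_; proj₂)
open import Data.Sum using (_⊎_; inj₁; inj₂; [_,_]′)
open import Function using (_∘_)
open import Relation.Nullary using (¬_; Dec; yes; no)
open import Relation.Nullary.Decidable using (_⊎-dec_)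
open import Relation.Unary using (Decidable)
open import Relation.Binary.PropositionalEquality using (_≡_; _≢_; refl; sym; ≢-sym; cong; subst; module ≡-Reasoning)

module _ {A : Set} where

  ∉-++⁺ : ∀ {v : A} {xs ys} → v ∉ xs → v ∉ ys → v ∉ xs ++ ys
  ∉-++⁺ {xs = xs} v∉xs v∉ys v∈ with ∈-++⁻ xs v∈
  ... | inj₁ v∈xs = v∉xs v∈xs
  ... | inj₂ v∈ys = v∉ys v∈ys

  All¬⇒∉ : ∀ {P : A → Set} {v xs} → All (¬_ ∘ P) xs → P v → v ∉ xs
  All¬⇒∉ ¬Ps Pv v∈ = All.lookup ¬Ps v∈ Pv

  Unique-rotateˡ : ∀ {x : A} xs → Unique (x ∷ xs) → Unique (xs ++ [ x ])
  Unique-rotateˡ [] u = u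
  Unique-rotateˡ (y ∷ ys) ((x≢y ∷ x≢ys) ∷ y≢ys ∷ u) =
    ++⁺ y≢ys (≢-sym x≢y ∷ All.[]) ∷ Unique-rotateˡ ys (x≢ys ∷ u)

  Unique-rotateʳ : ∀ {x : A} xs → Unique (xs ++ [ x ]) → Unique (x ∷ xs)
  Unique-rotateʳ [] u = u
  Unique-rotateʳ (y ∷ ys) (y≢ys∷ʳx ∷ u) with Unique-rotateʳ ys u | ++⁻ ys y≢ys∷ʳx
  ... | x≢ys ∷ uys | y≢ys , y≢x ∷ _ = (≢-sym y≢x ∷ x≢ys) ∷ y≢ys ∷ uys

either? : ∀ {n} (i j : Fin n) → Decidable (λ v → v ≡ i ⊎ v ≡ j)
either? i j v = (v ≟ i) ⊎-dec (v ≟ j)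

module _ {n : ℕ} {G : Digraph n} where

  open import Data.List.Membership.DecPropositional (_≟_ {n}) using (_∈?_)

  visited : ∀ {a b} → Walk G a b → List (Fin n)
  visited here = []
  visited (step {b = x} _ w) = x ∷ visited w

  vertices : ∀ {a b} → Walk G a b → List (Fin n)
  vertices {a} w = a ∷ visited w

  initVertices : ∀ {a b} → Walk G a b → List (Fin n)
  initVertices here = []
  initVertices (step {a = a} _ w) = a ∷ initVertices w

  initVertices-∷ʳ : ∀ {a b} (w : Walk G a b) → initVertices w ++ [ b ] ≡ vertices w
  initVertices-∷ʳ here = refl
  initVertices-∷ʳ (step _ w) = cong (_ ∷_) (initVertices-∷ʳ w)

  target∈vertices : ∀ {a b} (w : Walk G a b) → b ∈ vertices w
  target∈vertices here = here refl
  target∈vertices (step _ w) = there (target∈vertices w)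

  vertices-linked : ∀ {a b} (w : Walk G a b) → Linked (Edge G) (vertices w)
  vertices-linked here = [-]
  vertices-linked (step e w) = e ∷ vertices-linked w

  _++ʷ_ : ∀ {a b c} → Walk G a b → Walk G b c → Walk G a c
  here ++ʷ w′ = w′
  step e w ++ʷ w′ = step e (w ++ʷ w′)

  vertices-++ʷ : ∀ {a b c} (w : Walk G a b) (w′ : Walk G b c) →
                 vertices (w ++ʷ w′) ≡ vertices w ++ visited w′
  vertices-++ʷ here w′ = refl
  vertices-++ʷ (step {a = a} _ w) w′ = cong (a ∷_) (vertices-++ʷ w w′)

  ∉-++ʷ : ∀ {a b c v} (w : Walk G a b) (w′ : Walk G b c) →
          v ∉ vertices w → v ∉ visited w′ → v ∉ vertices (w ++ʷ w′)
  ∉-++ʷ {v = v} w w′ v∉w v∉w′ = ∉-++⁺ v∉w v∉w′ ∘ subst (v ∈_) (vertices-++ʷ w w′)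

  WalkAvoiding⇒Walk : ∀ {ν a b} → WalkAvoiding G ν a b → Σ (Walk G a b) (λ w → ν ∉ visited w)
  WalkAvoiding⇒Walk here = here , λ ()
  WalkAvoiding⇒Walk (step e x≢ν p) with WalkAvoiding⇒Walk p
  ... | w , ν∉w = step e w , λ { (here ν≡x) → x≢ν (sym ν≡x) ; (there ν∈w) → ν∉w ν∈w }

  Walk⇒WalkAvoiding : ∀ {ν a b} (w : Walk G a b) → ν ∉ visited w → WalkAvoiding G ν a b
  Walk⇒WalkAvoiding here _ = here
  Walk⇒WalkAvoiding (step e w) ν∉ =
    step e (λ x≡ν → ν∉ (here (sym x≡ν))) (Walk⇒WalkAvoiding w (ν∉ ∘ there))

  suffixFrom : ∀ {a b v} (w : Walk G a b) → v ∈ vertices w → Walk G v b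
  suffixFrom w (here refl) = w
  suffixFrom (step _ w) (there v∈) = suffixFrom w v∈

  suffixFrom-⊆ : ∀ {a b v} (w : Walk G a b) (v∈ : v ∈ vertices w) →
                 vertices (suffixFrom w v∈) ⊆ vertices w
  suffixFrom-⊆ w (here refl) u∈ = u∈
  suffixFrom-⊆ (step _ w) (there v∈) u∈ = there (suffixFrom-⊆ w v∈ u∈)

  suffixFrom-unique : ∀ {a b v} (w : Walk G a b) (v∈ : v ∈ vertices w) →
                      Unique (vertices w) → Unique (vertices (suffixFrom w v∈))
  suffixFrom-unique w (here refl) u = u
  suffixFrom-unique (step _ w) (there v∈) (_ ∷ u) = suffixFrom-unique w v∈ u

  cutOrPrepend : ∀ {a x b} → Edge G a x → (w : Walk G x b) → Dec (a ∈ vertices w) → Walk G a b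
  cutOrPrepend e w (yes a∈) = suffixFrom w a∈
  cutOrPrepend e w (no _) = step e w

  cutOrPrepend-⊆ : ∀ {a x b} (e : Edge G a x) (w : Walk G x b) (a∈? : Dec (a ∈ vertices w)) →
                   vertices (cutOrPrepend e w a∈?) ⊆ a ∷ vertices w
  cutOrPrepend-⊆ e w (yes a∈) = there ∘ suffixFrom-⊆ w a∈
  cutOrPrepend-⊆ e w (no _) = λ v∈ → v∈

  cutOrPrepend-unique : ∀ {a x b} (e : Edge G a x) (w : Walk G x b) (a∈? : Dec (a ∈ vertices w)) →
                        Unique (vertices w) → Unique (vertices (cutOrPrepend e w a∈?))
  cutOrPrepend-unique e w (yes a∈) u = suffixFrom-unique w a∈ u
  cutOrPrepend-unique e w (no a∉) u = ¬Any⇒All¬ _ a∉ ∷ u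

  loopErase : ∀ {a b} → Walk G a b → Walk G a b
  loopErase here = here
  loopErase (step {a = a} e w) = cutOrPrepend e (loopErase w) (a ∈? vertices (loopErase w))

  loopErase-⊆ : ∀ {a b} (w : Walk G a b) → vertices (loopErase w) ⊆ vertices w
  loopErase-⊆ here v∈ = v∈
  loopErase-⊆ (step {a = a} e w) v∈
    with cutOrPrepend-⊆ e (loopErase w) (a ∈? vertices (loopErase w)) v∈
  ... | here v≡a = here v≡a
  ... | there v∈′ = there (loopErase-⊆ w v∈′)

  loopErase-unique : ∀ {a b} (w : Walk G a b) → Unique (vertices (loopErase w))
  loopErase-unique here = All.[] ∷ []
  loopErase-unique (step {a = a} e w) =
    cutOrPrepend-unique e (loopErase w) (a ∈? vertices (loopErase w)) (loopErase-unique w)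

  loopErase-step : ∀ {a x b} (e : Edge G a x) (w : Walk G x b) → a ∉ vertices w →
                   vertices (loopErase (step e w)) ≡ a ∷ vertices (loopErase w)
  loopErase-step {a} e w a∉ with a ∈? vertices (loopErase w)
  ... | yes a∈ = ⊥-elim (a∉ (loopErase-⊆ w a∈))
  ... | no _ = refl

  departure : ∀ {a b} → a ≢ b → (w : Walk G a b) →
    ∃ λ x → Edge G a x × Σ (Walk G x b) (λ w′ → Unique (a ∷ vertices w′) × vertices w′ ⊆ visited w)
  departure {a} a≢b w with loopErase w | loopErase-unique w | loopErase-⊆ w
  ... | here | _ | _ = ⊥-elim (a≢b refl)
  ... | step e w′ | u | ⊆w = _ , e , w′ , u , ⊆visited
    where
    ⊆visited : vertices w′ ⊆ visited w
    ⊆visited v∈ with ⊆w (there v∈)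
    ... | here refl = ⊥-elim (Unique[x∷xs]⇒x∉xs u v∈)
    ... | there v∈w = v∈w

  Reach∖⇒departure : ∀ {ν δ k} → Reach∖ G ν δ k →
    ∃ λ x → Edge G δ x × Σ (Walk G x k) (λ w → δ ∉ vertices w × ν ∉ vertices w)
  Reach∖⇒departure (k≢δ , _ , p) with WalkAvoiding⇒Walk p
  ... | w₀ , ν∉w₀ with departure (k≢δ ∘ sym) w₀
  ... | x , δ→x , w , u , ⊆w₀ = x , δ→x , w , Unique[x∷xs]⇒x∉xs u , ν∉w₀ ∘ ⊆w₀

  module _ {P : Fin n → Set} (P? : Decidable P) where

    firstEntry : ∀ {a b} → Walk G a b → ¬ P a → P b →
      ∃₂ λ z h → Σ (Walk G a z) (λ w → All (¬_ ∘ P) (vertices w)) × Edge G z h × P h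
    firstEntry here ¬Pa Pb = ⊥-elim (¬Pa Pb)
    firstEntry (step {b = x} e w) ¬Pa Pb with P? x
    ... | yes Px = _ , _ , (here , ¬Pa ∷ All.[]) , e , Px
    ... | no ¬Px with firstEntry w ¬Px Pb
    ...   | z , h , (w′ , ¬Pw′) , z→h , Ph = z , h , (step e w′ , ¬Pa ∷ ¬Pw′) , z→h , Ph

    lastEntry : ∀ {a b} (w : Walk G a b) → Any P (vertices w) →
      ∃ λ s → P s × Σ (Walk G s b) (λ w′ → All (¬_ ∘ P) (visited w′))
    lastEntry here (here Pa) = _ , Pa , here , All.[]
    lastEntry (step e w) P∈ with any? P? (vertices w)
    ... | yes P∈w = lastEntry w P∈w
    ... | no P∉w with P∈
    ...   | here Pa = _ , Pa , step e w , ¬Any⇒All¬ _ P∉w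
    ...   | there P∈w = ⊥-elim (P∉w P∈w)

  Reach∖-cover : StronglyConnected G → ∀ i j k →
    (k ≡ i ⊎ k ≡ j) ⊎ Reach∖ G j i k ⊎ Reach∖ G i j k
  Reach∖-cover connected i j k with either? i j k
  ... | yes k∈ij = inj₁ k∈ij
  ... | no k∉ij with lastEntry (either? i j) (connected i k) (here (inj₁ refl))
  ...   | _ , inj₁ refl , w , ¬ij =
    inj₂ (inj₁ (k∉ij ∘ inj₁ , k∉ij ∘ inj₂ , Walk⇒WalkAvoiding w (All¬⇒∉ ¬ij (inj₂ refl))))
  ...   | _ , inj₂ refl , w , ¬ij =
    inj₂ (inj₂ (k∉ij ∘ inj₂ , k∉ij ∘ inj₁ , Walk⇒WalkAvoiding w (All¬⇒∉ ¬ij (inj₁ refl))))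

module Cactus {n : ℕ} {G : Digraph n} (simple : IsSimple G)
       (connected : StronglyConnected G) (cycle-unique : EveryEdgeOnUniqueCycle G) where

  edge⇒≢ : ∀ {a b} → Edge G a b → a ≢ b
  edge⇒≢ {a} e refl = subst T (simple a) e

  returnCycle : ∀ {a b} → Edge G a b → (w : Walk G b a) → Unique (vertices w) →
                CycleThrough G a b (a ∷ initVertices w)
  returnCycle a→b here _ = ⊥-elim (edge⇒≢ a→b refl)
  returnCycle {a} a→b w@(step _ w′) u =
    (initVertices w′ , refl) ,
    Unique-rotateʳ (initVertices w) (subst Unique (sym (initVertices-∷ʳ w)) u) ,
    subst (Linked (Edge G)) (cong (a ∷_) (sym (initVertices-∷ʳ w))) (a→b ∷ vertices-linked w)

  simpleReturn-unique : ∀ {a b} → Edge G a b → (w w′ : Walk G b a) →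
    Unique (vertices w) → Unique (vertices w′) → vertices w ≡ vertices w′
  simpleReturn-unique {a} a→b w w′ u u′ = begin
    vertices w               ≡⟨ initVertices-∷ʳ w ⟨
    initVertices w ++ [ a ]  ≡⟨ cong (_++ [ a ]) (∷-injectiveʳ same-cycle) ⟩
    initVertices w′ ++ [ a ] ≡⟨ initVertices-∷ʳ w′ ⟩
    vertices w′              ∎
    where
    open ≡-Reasoning
    same-cycle : a ∷ initVertices w ≡ a ∷ initVertices w′
    same-cycle = proj₂ (cycle-unique _ _ a→b) _ _ (returnCycle a→b w u) (returnCycle a→b w′ u′)

  simpleReturn-⊆ : ∀ {a b} → Edge G a b → (w : Walk G b a) → Unique (vertices w) →
                   (w′ : Walk G b a) → vertices w ⊆ vertices w′
  simpleReturn-⊆ a→b w u w′ {v} v∈ = loopErase-⊆ w′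
    (subst (v ∈_) (simpleReturn-unique a→b w (loopErase w′) u (loopErase-unique w′)) v∈)

  returnWalk-firstStep : ∀ {a b x y} → Edge G a b →
    Edge G b x → (w : Walk G x a) → b ∉ vertices w →
    Edge G b y → (w′ : Walk G y a) → b ∉ vertices w′ → x ≡ y
  returnWalk-firstStep {b = b} a→b b→x w b∉w b→y w′ b∉w′ = ∷-injectiveˡ (∷-injectiveʳ (begin
    b ∷ vertices (loopErase w)          ≡⟨ loopErase-step b→x w b∉w ⟨
    vertices (loopErase (step b→x w))   ≡⟨ simpleReturn-unique a→b _ _
                                             (loopErase-unique (step b→x w)) (loopErase-unique (step b→y w′)) ⟩
    vertices (loopErase (step b→y w′))  ≡⟨ loopErase-step b→y w′ b∉w′ ⟩
    b ∷ vertices (loopErase w′)         ∎))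
    where open ≡-Reasoning

  module _ {i j k x y z} (i→j : Edge G i j)
           (i→x : Edge G i x) (P : Walk G x k) (i∉P : i ∉ vertices P) (j∉P : j ∉ vertices P)
           (j→y : Edge G j y) (Q : Walk G y k) (j∉Q : j ∉ vertices Q) (i∉Q : i ∉ vertices Q)
           (R : Walk G k z) (i∉R : i ∉ visited R) (j∉R : j ∉ visited R) where

    private
      i∉[j] : i ∉ [ j ]
      i∉[j] (here i≡j) = edge⇒≢ i→j i≡j

    ¬enter-i : ¬ Edge G z i
    ¬enter-i z→i = j∉P (here j≡x)
      where
      j≡x : j ≡ x
      j≡x = returnWalk-firstStep z→i
        i→j (step j→y Q ++ʷ R) (∉-++ʷ (step j→y Q) R (∉-++⁺ i∉[j] i∉Q) i∉R)
        i→x (P ++ʷ R) (∉-++ʷ P R i∉P i∉R)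

    ¬enter-j : ¬ Edge G z j
    ¬enter-j z→j with departure (edge⇒≢ i→j ∘ sym) (connected j i)
    ... | c , j→c , C , uC , _
      with returnWalk-firstStep z→j
             j→y (Q ++ʷ R) (∉-++ʷ Q R j∉Q j∉R)
             j→c (C ++ʷ step i→x (P ++ʷ R)) (∉-++ʷ C _ (Unique[x∷xs]⇒x∉xs uC) (∉-++ʷ P R j∉P j∉R))
    ... | refl = ∉-++ʷ (Q ++ʷ R) (step z→j here) (∉-++ʷ Q R i∉Q i∉R) i∉[j]
                   (simpleReturn-⊆ j→y D D-unique ((Q ++ʷ R) ++ʷ step z→j here) i∈D)
      where
      D : Walk G y j
      D = C ++ʷ step i→j here
      D-unique : Unique (vertices D)
      D-unique = subst Unique (sym (vertices-++ʷ C _)) (Unique-rotateˡ (vertices C) uC)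
      i∈D : i ∈ vertices D
      i∈D = subst (i ∈_) (sym (vertices-++ʷ C _)) (∈-++⁺ˡ (target∈vertices C))

    ¬enter : ∀ {h} → h ≡ i ⊎ h ≡ j → ¬ Edge G z h
    ¬enter (inj₁ refl) = ¬enter-i
    ¬enter (inj₂ refl) = ¬enter-j

  Reach∖-disjoint : ∀ {i j k} → Edge G i j → Reach∖ G j i k → Reach∖ G i j k → ⊥
  Reach∖-disjoint {i} {j} {k} i→j reach-i@(k≢i , k≢j , _) reach-j
    with Reach∖⇒departure reach-i | Reach∖⇒departure reach-j
       | firstEntry (either? i j) (connected k i) [ k≢i , k≢j ]′ (inj₁ refl)
  ... | x , i→x , P , i∉P , j∉P | y , j→y , Q , j∉Q , i∉Q | z , h , (R , ¬ij-R) , z→h , h∈ij =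
    ¬enter i→j i→x P i∉P j∉P j→y Q j∉Q i∉Q R
      (All¬⇒∉ ¬ij-R (inj₁ refl) ∘ there) (All¬⇒∉ ¬ij-R (inj₂ refl) ∘ there) h∈ij z→h

lemma3p4 : (n : ℕ) (G : Digraph n) → IsDirectedCactus G →
    (i j : Fin n) → Edge G i j → 1 < degree G i → 1 < degree G j →
    (∀ k → (k ≡ i ⊎ k ≡ j) ⊎ Reach∖ G j i k ⊎ Reach∖ G i j k) ×
    (∀ k → ¬ ((k ≡ i ⊎ k ≡ j) × Reach∖ G j i k)) ×
    (∀ k → ¬ ((k ≡ i ⊎ k ≡ j) × Reach∖ G i j k)) ×
    (∀ k → ¬ (Reach∖ G j i k × Reach∖ G i j k))
lemma3p4 n G (simple , connected , cycle-unique) i j i→j _ _ =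
  Reach∖-cover connected i j ,
  (λ { k (inj₁ refl , k≢i , _) → k≢i refl ; k (inj₂ refl , _ , k≢j , _) → k≢j refl }) ,
  (λ { k (inj₁ refl , _ , k≢i , _) → k≢i refl ; k (inj₂ refl , k≢j , _) → k≢j refl }) ,
  λ k (reach-i , reach-j) → Reach∖-disjoint i→j reach-i reach-j
  where open Cactus simple connected cycle-unique
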